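{- Let $n$ be a positive integer. For any $\tau\in P_{n,1}$, $d(\tau)\in\{2n,n,\tfrac{n}{2}\}$. More precisely: if $n$ is odd, then $d(\tau)=2n$ for all $\tau\in P_{n,1}$; if $n\equiv 0\pmod 4$, then $d(\tau)\in\{2n,n\}$ for all $\tau\in P_{n,1}$; if $n\equiv 2\pmod 4$, then $d(\tau)\in\{2n,n,\tfrac n2\}$ for all $\tau\in P_{n,1}$.
   Context: Place $2n$ points on a circle, labeled $1,\dots,2n$ clockwise. A matching is a perfect matching of these points drawn as chords; two chords cross if their endpoints interleave in circular order. $P_{n,1}$ is the set of matchings with exactly one crossing pair of chords. The rotation $\sigma_{2n}$ sends each chord $\{a,b\}$ to $\{a+1,b+1\}$ (labels modulo $2n$). For a matching $\tau$, $d(\tau)$ is the smallest positive integer $j$ such that $\sigma_{2n}^j(\tau)=\tau$. -}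

module Defs where

open import Data.Nat using (ℕ; zero; suc; _+_; _*_; _<_; _<?_; _%_)
open import Data.Nat.DivMod using (m%n<n)
open import Data.Fin using (Fin; toℕ; fromℕ<)
open import Data.List using (List; map; allFin)
open import Data.Nat.ListAction using (sum)
open import Data.Bool using (if_then_else_)
open import Data.Product using (_×_; Σ)
open import Relation.Nullary using (¬_; does)
open import Relation.Nullary.Decidable using (_×-dec_)
open import Relation.Binary.PropositionalEquality using (_≡_; _≢_)

-- Points on the circle are 0,1,…,N-1 (the paper's labels 1,…,N shifted by one;
-- everything is rotation-invariant so this is harmless).  A matching is encoded
-- by its partner function: τ i is the point matched with i.
IsMatching : ∀ {N} → (Fin N → Fin N) → Set
IsMatching {N} τ = (i : Fin N) → (τ (τ i) ≡ i) × (τ i ≢ i)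

rot+ : ∀ {N} → Fin N → Fin N
rot+ {suc k} i = fromℕ< (m%n<n (suc (toℕ i)) (suc k))

rot- : ∀ {N} → Fin N → Fin N
rot- {suc k} i = fromℕ< (m%n<n (toℕ i + k) (suc k))

-- The rotation σ_N on matchings: chord {a,b} ↦ {a+1,b+1}, i.e.
-- (σ τ)(a+1) = τ(a) + 1.
σ : ∀ {N} → (Fin N → Fin N) → (Fin N → Fin N)
σ τ i = rot+ (τ (rot- i))

σ^ : ∀ {N} → ℕ → (Fin N → Fin N) → (Fin N → Fin N)
σ^ zero    τ = τ
σ^ (suc j) τ = σ (σ^ j τ)

-- Number of crossing pairs of chords: a pair of chords {a,b},{c,d} with
-- a < b, c < d, a < c crosses iff a < c < b < d.  Each crossing pair is counted
-- exactly once as (a , c) with a < c < τ a < τ c.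
crossings : ∀ {N} → (Fin N → Fin N) → ℕ
crossings {N} τ =
  sum (map (λ a → sum (map (λ c →
    if does ((toℕ a <? toℕ c) ×-dec ((toℕ c <? toℕ (τ a)) ×-dec (toℕ (τ a) <? toℕ (τ c))))
    then 1 else 0) (allFin N))) (allFin N))

InP1 : (n : ℕ) → (Fin (2 * n) → Fin (2 * n)) → Set
InP1 n τ = IsMatching τ × (crossings τ ≡ 1)

_≈ₘ_ : ∀ {N} → (Fin N → Fin N) → (Fin N → Fin N) → Set
_≈ₘ_ {N} τ τ' = (i : Fin N) → τ i ≡ τ' i

IsRotOrder : ∀ {N} → (Fin N → Fin N) → ℕ → Set
IsRotOrder τ d = (0 < d) × (σ^ d τ ≈ₘ τ) × ((k : ℕ) → 0 < k → k < d → ¬ (σ^ k τ ≈ₘ τ))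

-- A period d of τ maps the unique crossing pair of chords {a,b}, {c,e}
-- (a < c < b < e) to itself.  Sorting the rotated endpoints by how many of them
-- pass the point N - 1 leaves, besides d = N, two possibilities: the rotation
-- swaps the two chords, with c = a + d, b = c + d, e = b + d and N = 4d, or it
-- fixes each chord, with b = a + d and N = 2d.  The other cases contradict d > 0
-- or 2d ≤ N, and when d < N minimality gives 2d ≤ N, since otherwise 2d - N would
-- be a smaller period.  No chord can leave the arcs (a,c) and (c,b) without
-- creating a second crossing, so each arc holds an even number of points and
-- c - a, b - c are odd.  Hence d is odd when N = 4d and even when N = 2d.
module Submission where

open import Defs
open import Data.Nat using (ℕ; zero; suc; _+_; _*_; _∸_; _<_; _≤_; _%_; _<?_; _≤?_; _≟_; z<s; NonZero)
open import Data.Nat.Properties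
open import Data.Nat.DivMod using (m%n<n; m%n%n≡m%n; [m+n]%n≡m%n; [m+kn]%n≡m%n; m<n⇒m%n≡m; %-distribˡ-+; m*n%n≡0; m%n*o≡m*o%[n*o])
open import Data.Nat.Divisibility using (_∣_; _∣0; ∣-refl; ∣m∣n⇒∣m+n)
open import Data.Nat.Tactic.RingSolver using (solve-∀)
open import Data.Nat.ListAction using (sum)
open import Data.Fin using (Fin; toℕ; fromℕ<) renaming (zero to fzero; suc to fsuc)
open import Data.Fin.Properties using (toℕ-fromℕ<; toℕ-injective; toℕ<n) renaming (_≟_ to _≟ᶠ_)
open import Data.List using (map; allFin; tabulate)
open import Data.List.Properties using (map-tabulate; tabulate-cong)
open import Data.Bool using (Bool; true; false; if_then_else_)
open import Data.Product using (_×_; _,_; proj₁; proj₂; ∃; ∃₂)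
open import Data.Sum using (_⊎_; inj₁; inj₂)
open import Data.Empty using (⊥; ⊥-elim)
open import Function using (_∘_; id; const)
open import Relation.Binary.Definitions using (tri<; tri≈; tri>)
open import Relation.Binary.PropositionalEquality
open import Relation.Nullary using (¬_; Dec; does; yes; no)
open import Relation.Nullary.Decidable using (_×-dec_; dec-true; dec-false)

[m%n+k]%n≡[m+k]%n : ∀ m k n .{{_ : NonZero n}} → (m % n + k) % n ≡ (m + k) % n
[m%n+k]%n≡[m+k]%n m k n = begin
  (m % n + k) % n           ≡⟨ %-distribˡ-+ (m % n) k n ⟩
  (m % n % n + k % n) % n   ≡⟨ cong (λ z → (z + k % n) % n) (m%n%n≡m%n m n) ⟩
  (m % n + k % n) % n       ≡⟨ %-distribˡ-+ m k n ⟨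
  (m + k) % n               ∎
  where open ≡-Reasoning

term≤sum : ∀ {n} (f : Fin n → ℕ) i → f i ≤ sum (tabulate f)
term≤sum f fzero    = m≤m+n _ _
term≤sum f (fsuc i) = ≤-trans (term≤sum (f ∘ fsuc) i) (m≤n+m _ (f fzero))

two-terms≤sum : ∀ {n} (f : Fin n → ℕ) {i j} → i ≢ j → f i + f j ≤ sum (tabulate f)
two-terms≤sum f {fzero}  {fzero}  i≢j = ⊥-elim (i≢j refl)
two-terms≤sum f {fzero}  {fsuc j} _   = +-monoʳ-≤ (f fzero) (term≤sum (f ∘ fsuc) j)
two-terms≤sum f {fsuc i} {fzero}  _   =
  subst (_≤ sum (tabulate f)) (+-comm (f fzero) (f (fsuc i))) (+-monoʳ-≤ (f fzero) (term≤sum (f ∘ fsuc) i))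
two-terms≤sum f {fsuc i} {fsuc j} i≢j =
  ≤-trans (two-terms≤sum (f ∘ fsuc) (i≢j ∘ cong fsuc)) (m≤n+m _ (f fzero))

positive-sum⇒positive-term : ∀ {n} (f : Fin n → ℕ) → 0 < sum (tabulate f) → ∃ λ i → 0 < f i
positive-sum⇒positive-term {suc n} f 0<sum with f fzero in eq
... | suc _ = fzero , subst (0 <_) (sym eq) z<s
... | zero  with positive-sum⇒positive-term (f ∘ fsuc) 0<sum
...   | i , 0<fi = fsuc i , 0<fi

module Crossings {N : ℕ} (τ : Fin N → Fin N) where

  CrossingPair : Fin N → Fin N → Set
  CrossingPair a c = toℕ a < toℕ c × toℕ c < toℕ (τ a) × toℕ (τ a) < toℕ (τ c)

  crossingPair? : ∀ a c → Dec (CrossingPair a c)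
  crossingPair? a c = (toℕ a <? toℕ c) ×-dec ((toℕ c <? toℕ (τ a)) ×-dec (toℕ (τ a) <? toℕ (τ c)))

  indicator : Fin N → Fin N → ℕ
  indicator a c = if does (crossingPair? a c) then 1 else 0

  crossingsFrom : Fin N → ℕ
  crossingsFrom a = sum (tabulate (indicator a))

  crossings≡sum-crossingsFrom : crossings τ ≡ sum (tabulate crossingsFrom)
  crossings≡sum-crossingsFrom = begin
    crossings τ                                          ≡⟨ cong sum (map-tabulate id (λ a → sum (map (indicator a) (allFin N)))) ⟩
    sum (tabulate (λ a → sum (map (indicator a) (allFin N)))) ≡⟨ cong sum (tabulate-cong (λ a → cong sum (map-tabulate id (indicator a)))) ⟩
    sum (tabulate crossingsFrom)                         ∎
    where open ≡-Reasoning

  indicator-crossing : ∀ {a c} → CrossingPair a c → indicator a c ≡ 1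
  indicator-crossing {a} {c} p rewrite dec-true (crossingPair? a c) p = refl

  indicator-no-crossing : ∀ {a c} → ¬ CrossingPair a c → indicator a c ≡ 0
  indicator-no-crossing {a} {c} ¬p rewrite dec-false (crossingPair? a c) ¬p = refl

  positive-indicator : ∀ a c → 0 < indicator a c → CrossingPair a c
  positive-indicator a c 0<ind with crossingPair? a c
  ... | yes p  = p
  ... | no  ¬p = ⊥-elim (n≮0 (subst (0 <_) (indicator-no-crossing ¬p) 0<ind))

  crossingsFrom-crossing : ∀ {a c} → CrossingPair a c → 1 ≤ crossingsFrom a
  crossingsFrom-crossing {a} {c} p = subst (_≤ crossingsFrom a) (indicator-crossing p) (term≤sum (indicator a) c)

  module _ (one : crossings τ ≡ 1) where

    private
      total≡1 : sum (tabulate crossingsFrom) ≡ 1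
      total≡1 = trans (sym crossings≡sum-crossingsFrom) one

    one-crossing⇒crossingPair : ∃₂ λ a c → CrossingPair a c
    one-crossing⇒crossingPair with positive-sum⇒positive-term crossingsFrom (subst (0 <_) (sym total≡1) z<s)
    ... | a , 0<from-a with positive-sum⇒positive-term (indicator a) 0<from-a
    ...   | c , 0<ind = a , c , positive-indicator a c 0<ind

    crossingPair-unique : ∀ {a c a′ c′} → CrossingPair a c → CrossingPair a′ c′ → a ≡ a′ × c ≡ c′
    crossingPair-unique {a} {c} {a′} {c′} p p′ with a ≟ᶠ a′ | c ≟ᶠ c′
    ... | yes refl | yes refl = refl , refl
    ... | no a≢a′  | _        = ⊥-elim (<-irrefl refl (begin
      2                                   ≤⟨ +-mono-≤ (crossingsFrom-crossing p) (crossingsFrom-crossing p′) ⟩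
      crossingsFrom a + crossingsFrom a′  ≤⟨ two-terms≤sum crossingsFrom a≢a′ ⟩
      sum (tabulate crossingsFrom)        ≡⟨ total≡1 ⟩
      1                                   ∎))
      where open ≤-Reasoning
    ... | yes refl | no c≢c′  = ⊥-elim (<-irrefl refl (begin
      2                                   ≡⟨ cong₂ _+_ (indicator-crossing p) (indicator-crossing p′) ⟨
      indicator a c + indicator a c′      ≤⟨ two-terms≤sum (indicator a) c≢c′ ⟩
      crossingsFrom a                     ≤⟨ term≤sum crossingsFrom a ⟩
      sum (tabulate crossingsFrom)        ≡⟨ total≡1 ⟩
      1                                   ∎))
      where open ≤-Reasoning

count : (ℕ → Bool) → ℕ → ℕ → ℕ
count S lo zero    = 0
count S lo (suc L) = (if S lo then 1 else 0) + count S (suc lo) L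

remove : ℕ → (ℕ → Bool) → ℕ → Bool
remove x S z = if does (z ≟ x) then false else S z

false≢true : false ≢ true
false≢true ()

remove-self : ∀ x S → remove x S x ≡ false
remove-self x S rewrite dec-true (x ≟ x) refl = refl

remove-other : ∀ {x z} S → z ≢ x → remove x S z ≡ S z
remove-other {x} {z} S z≢x rewrite dec-false (z ≟ x) z≢x = refl

count-remove-below : ∀ {x} S lo L → x < lo → count (remove x S) lo L ≡ count S lo L
count-remove-below S lo zero    x<lo = refl
count-remove-below S lo (suc L) x<lo rewrite remove-other S (>⇒≢ x<lo) =
  cong (_ +_) (count-remove-below S (suc lo) L (m<n⇒m<1+n x<lo))

count-remove : ∀ {x} S lo L → lo ≤ x → x < lo + L → S x ≡ true →
               suc (count (remove x S) lo L) ≡ count S lo L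
count-remove S lo zero lo≤x x<lo+0 _ = ⊥-elim (<⇒≱ x<lo+0 (≤-trans (≤-reflexive (+-identityʳ lo)) lo≤x))
count-remove {x} S lo (suc L) lo≤x x<lo+1+L Sx with lo ≟ x
... | yes refl rewrite remove-self lo S | Sx = cong suc (count-remove-below S (suc lo) L ≤-refl)
... | no lo≢x  rewrite remove-other S lo≢x =
  trans (sym (+-suc _ _))
    (cong (_ +_) (count-remove S (suc lo) L (≤∧≢⇒< lo≤x lo≢x) (subst (x <_) (+-suc lo L) x<lo+1+L) Sx))

positive-count⇒member : ∀ S lo L → 0 < count S lo L → ∃ λ x → lo ≤ x × x < lo + L × S x ≡ true
positive-count⇒member S lo (suc L) 0<count with S lo in Slo
... | true  = lo , ≤-refl , m<m+n lo z<s , Slo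
... | false with positive-count⇒member S (suc lo) L 0<count
...   | x , lo<x , x<hi , Sx = x , <⇒≤ lo<x , subst (x <_) (sym (+-suc lo L)) x<hi , Sx

count-all : ∀ lo L → count (const true) lo L ≡ L
count-all lo zero    = refl
count-all lo (suc L) = cong suc (count-all (suc lo) L)

module FixedPointFreeInvolution (T : ℕ → ℕ) (lo L : ℕ)
  (T-closed : ∀ {z} → lo ≤ z → z < lo + L → lo ≤ T z × T z < lo + L)
  (T-involutive : ∀ {z} → lo ≤ z → z < lo + L → T (T z) ≡ z)
  (T-no-fixed-point : ∀ {z} → lo ≤ z → z < lo + L → T z ≢ z) where

  Closed : (ℕ → Bool) → Set
  Closed S = ∀ {z} → lo ≤ z → z < lo + L → S z ≡ true → S (T z) ≡ true

  remove-orbit : ∀ S → Closed S → 0 < count S lo L →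
                 ∃ λ S′ → Closed S′ × suc (suc (count S′ lo L)) ≡ count S lo L
  remove-orbit S closed 0<count with positive-count⇒member S lo L 0<count
  ... | x , lo≤x , x<hi , Sx = remove (T x) (remove x S) , closed′ , counts
    where
      Tx≢x = T-no-fixed-point lo≤x x<hi
      lo≤Tx = proj₁ (T-closed lo≤x x<hi)
      Tx<hi = proj₂ (T-closed lo≤x x<hi)

      counts : suc (suc (count (remove (T x) (remove x S)) lo L)) ≡ count S lo L
      counts = trans
        (cong suc (count-remove (remove x S) lo L lo≤Tx Tx<hi (trans (remove-other S Tx≢x) (closed lo≤x x<hi Sx))))
        (count-remove S lo L lo≤x x<hi Sx)

      closed′ : Closed (remove (T x) (remove x S))
      closed′ {z} lo≤z z<hi S′z with z ≟ T x | z ≟ x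
      ... | yes refl | _        = ⊥-elim (false≢true (trans (sym (remove-self (T x) (remove x S))) S′z))
      ... | no _     | yes refl =
        ⊥-elim (false≢true (trans (sym (trans (remove-other (remove x S) (Tx≢x ∘ sym)) (remove-self x S))) S′z))
      ... | no z≢Tx  | no z≢x   =
        trans (remove-other (remove x S) Tz≢Tx) (trans (remove-other S Tz≢x) (closed lo≤z z<hi Sz))
        where
          Sz : S z ≡ true
          Sz = trans (sym (trans (remove-other (remove x S) z≢Tx) (remove-other S z≢x))) S′z
          Tz≢Tx : T z ≢ T x
          Tz≢Tx Tz≡Tx = z≢x (begin
            z         ≡⟨ T-involutive lo≤z z<hi ⟨
            T (T z)   ≡⟨ cong T Tz≡Tx ⟩
            T (T x)   ≡⟨ T-involutive lo≤x x<hi ⟩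
            x         ∎)
            where open ≡-Reasoning
          Tz≢x : T z ≢ x
          Tz≢x Tz≡x = z≢Tx (trans (sym (T-involutive lo≤z z<hi)) (cong T Tz≡x))

  closed-count-even : ∀ m S → Closed S → count S lo L ≡ m → 2 ∣ m
  closed-count-even zero S _ _ = 2 ∣0
  closed-count-even (suc m) S closed count≡ with remove-orbit S closed (subst (0 <_) (sym count≡) z<s)
  closed-count-even (suc zero)    S closed count≡ | _ , _ , counts = ⊥-elim (1+n≢0 (suc-injective (trans counts count≡)))
  closed-count-even (suc (suc m)) S closed count≡ | S′ , closed′ , counts =
    ∣m∣n⇒∣m+n ∣-refl (closed-count-even m S′ closed′ (suc-injective (suc-injective (trans counts count≡))))

  length-even : 2 ∣ L
  length-even = closed-count-even L (const true) (λ _ _ _ → refl) (count-all lo L)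

m+n+n≡2*n+m : ∀ m n → m + n + n ≡ 2 * n + m
m+n+n≡2*n+m = solve-∀

m+n+n+n+n≡4*n+m : ∀ m n → m + n + n + n + n ≡ 4 * n + m
m+n+n+n+n≡4*n+m = solve-∀

Crosses : (ℕ → ℕ) → ℕ → ℕ → Set
Crosses T x y = x < y × y < T x × T x < T y

module OneCrossing {N : ℕ} (T : ℕ → ℕ)
  (T<N : ∀ x → T x < N)
  (T-involutive : ∀ {x} → x < N → T (T x) ≡ x)
  (T-no-fixed-point : ∀ {x} → x < N → T x ≢ x)
  {a c : ℕ} (a-c-cross : Crosses T a c)
  (crossing-unique : ∀ {x y} → Crosses T x y → x ≡ a × y ≡ c) where

  b e : ℕ
  b = T a
  e = T c

  a<c : a < c
  a<c = proj₁ a-c-cross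

  c<b : c < b
  c<b = proj₁ (proj₂ a-c-cross)

  b<e : b < e
  b<e = proj₂ (proj₂ a-c-cross)

  b<N : b < N
  b<N = T<N a

  e<N : e < N
  e<N = T<N c

  c<N : c < N
  c<N = <-trans c<b b<N

  a<N : a < N
  a<N = <-trans a<c c<N

  T-b : T b ≡ a
  T-b = T-involutive a<N

  T-e : T e ≡ c
  T-e = T-involutive c<N

  crossing-at : ∀ {p q r s} → p < q → q < r → r < s → T p ≡ r → T q ≡ s → p ≡ a × q ≡ c
  crossing-at p<q q<r r<s refl refl = crossing-unique (p<q , q<r , r<s)

  arc-ab-closed : ∀ {x} → a < x → x < b → x ≢ c → a < T x × T x < b
  arc-ab-closed {x} a<x x<b x≢c with <-cmp (T x) a | <-cmp (T x) b
  ... | tri< Tx<a _ _ | _ =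
    ⊥-elim (<-irrefl (proj₁ (crossing-at Tx<a a<x x<b (T-involutive x<N) refl)) Tx<a)
    where x<N = <-trans x<b b<N
  ... | tri≈ _ Tx≡a _ | _ =
    ⊥-elim (<-irrefl (trans (sym (T-involutive (<-trans x<b b<N))) (cong T Tx≡a)) x<b)
  ... | tri> _ _ a<Tx | tri< Tx<b _ _ = a<Tx , Tx<b
  ... | tri> _ _ _    | tri≈ _ Tx≡b _ =
    ⊥-elim (<-irrefl (trans (sym T-b) (trans (cong T (sym Tx≡b)) (T-involutive (<-trans x<b b<N)))) a<x)
  ... | tri> _ _ _    | tri> _ _ b<Tx =
    ⊥-elim (x≢c (proj₂ (crossing-at a<x x<b b<Tx refl refl)))

  arc-ac-closed : ∀ {x} → a < x → x < c → a < T x × T x < c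
  arc-ac-closed {x} a<x x<c with arc-ab-closed a<x (<-trans x<c c<b) (<⇒≢ x<c) | <-cmp (T x) c
  ... | a<Tx , _   | tri< Tx<c _ _ = a<Tx , Tx<c
  ... | _          | tri≈ _ Tx≡c _ =
    ⊥-elim (<-asym x<c (begin-strict
      c       <⟨ <-trans c<b b<e ⟩
      T c     ≡⟨ cong T Tx≡c ⟨
      T (T x) ≡⟨ T-involutive (<-trans x<c c<N) ⟩
      x       ∎))
    where open ≤-Reasoning
  ... | _ , Tx<b   | tri> _ _ c<Tx =
    ⊥-elim (<-irrefl (sym (proj₁ (crossing-at x<c c<Tx (<-trans Tx<b b<e) refl refl))) a<x)

  arc-cb-closed : ∀ {x} → c < x → x < b → c < T x × T x < b
  arc-cb-closed {x} c<x x<b with arc-ab-closed (<-trans a<c c<x) x<b (>⇒≢ c<x) | <-cmp (T x) c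
  ... | a<Tx , _   | tri< Tx<c _ _ =
    ⊥-elim (<-irrefl (sym (proj₁ (crossing-at Tx<c c<x (<-trans x<b b<e) (T-involutive (<-trans x<b b<N)) refl))) a<Tx)
  ... | _          | tri≈ _ Tx≡c _ =
    ⊥-elim (<-asym x<b (begin-strict
      b       <⟨ b<e ⟩
      T c     ≡⟨ cong T Tx≡c ⟨
      T (T x) ≡⟨ T-involutive (<-trans x<b b<N) ⟩
      x       ∎))
    where open ≤-Reasoning
  ... | _ , Tx<b   | tri> _ _ c<Tx = c<Tx , Tx<b

  closed-arc-odd : ∀ {lo hi} → lo < hi → hi ≤ N → (∀ {z} → lo < z → z < hi → lo < T z × T z < hi) →
                   (hi ∸ lo) % 2 ≡ 1
  closed-arc-odd {lo} {hi} lo<hi hi≤N closed = begin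
    (hi ∸ lo) % 2            ≡⟨ cong (λ m → (m ∸ lo) % 2) hi≡ ⟨
    (suc lo + L ∸ lo) % 2    ≡⟨ cong (λ m → (m ∸ lo) % 2) (+-suc lo L) ⟨
    (lo + suc L ∸ lo) % 2    ≡⟨ cong (_% 2) (m+n∸m≡n lo (suc L)) ⟩
    suc L % 2                ≡⟨ cong (λ m → suc m % 2) (_∣_.equality L-even) ⟩
    (1 + q * 2) % 2          ≡⟨ [m+kn]%n≡m%n 1 q 2 ⟩
    1                        ∎
    where
      open ≡-Reasoning
      L = hi ∸ suc lo
      hi≡ : suc lo + L ≡ hi
      hi≡ = m+[n∸m]≡n lo<hi
      below-hi : ∀ {z} → z < suc lo + L → z < hi
      below-hi = subst (_ <_) hi≡
      L-even : 2 ∣ L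
      L-even = FixedPointFreeInvolution.length-even T (suc lo) L
        (λ lo<z z<hi → let lo<Tz , Tz<hi = closed lo<z (below-hi z<hi) in lo<Tz , subst (_ <_) (sym hi≡) Tz<hi)
        (λ _ z<hi → T-involutive (<-≤-trans (below-hi z<hi) hi≤N))
        (λ _ z<hi → T-no-fixed-point (<-≤-trans (below-hi z<hi) hi≤N))
      q = _∣_.quotient L-even

  gap-ac-odd : (c ∸ a) % 2 ≡ 1
  gap-ac-odd = closed-arc-odd a<c (<⇒≤ c<N) arc-ac-closed

  gap-cb-odd : (b ∸ c) % 2 ≡ 1
  gap-cb-odd = closed-arc-odd c<b (<⇒≤ b<N) arc-cb-closed

  module Rotated .{{_ : NonZero N}} (d : ℕ) (0<d : 0 < d) (2d≤N : 2 * d ≤ N)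
    (T-shift : ∀ x → T ((x + d) % N) ≡ (T x + d) % N) where

    S : ℕ → ℕ
    S x = (x + d) % N

    d<N : d < N
    d<N = <-≤-trans (m<m+n d (<-≤-trans 0<d (m≤m+n d 0))) 2d≤N

    S-chord : ∀ {x y} → T x ≡ y → T (S x) ≡ S y
    S-chord refl = T-shift _

    unwrapped : ∀ {x} → x + d < N → S x ≡ x + d
    unwrapped = m<n⇒m%n≡m

    wrapped : ∀ {x} → x < N → N ≤ x + d → x + d ≡ N + S x × S x < d
    wrapped {x} x<N N≤x+d = subst (λ y → x + d ≡ N + y) (sym Sx≡w) x+d≡N+w , subst (_< d) (sym Sx≡w) w<d
      where
        w = x + d ∸ N
        x+d≡N+w : x + d ≡ N + w
        x+d≡N+w = sym (m+[n∸m]≡n N≤x+d)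
        w<d : w < d
        w<d = +-cancelˡ-< N w d (subst (_< N + d) x+d≡N+w (+-monoˡ-< d x<N))
        Sx≡w : S x ≡ w
        Sx≡w = begin
          (x + d) % N   ≡⟨ cong (_% N) (trans x+d≡N+w (+-comm N w)) ⟩
          (w + N) % N   ≡⟨ [m+n]%n≡m%n w N ⟩
          w % N         ≡⟨ m<n⇒m%n≡m (<-trans w<d d<N) ⟩
          w             ∎
          where open ≡-Reasoning

    unwrapped-below : ∀ {x y} → x < y → y + d < N → x + d < N
    unwrapped-below x<y = <-trans (+-monoˡ-< d x<y)

    wrapped-above : ∀ {x y} → x < y → N ≤ x + d → N ≤ y + d
    wrapped-above x<y N≤x+d = ≤-trans N≤x+d (+-monoˡ-≤ d (<⇒≤ x<y))

    S-mono-unwrapped : ∀ {x y} → x < y → y + d < N → S x < S y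
    S-mono-unwrapped x<y y+d<N =
      subst₂ _<_ (sym (unwrapped (unwrapped-below x<y y+d<N))) (sym (unwrapped y+d<N)) (+-monoˡ-< d x<y)

    S-mono-wrapped : ∀ {x y} → x < y → y < N → N ≤ x + d → S x < S y
    S-mono-wrapped x<y y<N N≤x+d = +-cancelˡ-< N _ _
      (subst₂ _<_ (proj₁ (wrapped (<-trans x<y y<N) N≤x+d)) (proj₁ (wrapped y<N (wrapped-above x<y N≤x+d)))
        (+-monoˡ-< d x<y))

    wrapped<unwrapped : ∀ {x y} → x < N → N ≤ x + d → y + d < N → S x < S y
    wrapped<unwrapped x<N N≤x+d y+d<N =
      subst (_ <_) (sym (unwrapped y+d<N)) (<-≤-trans (proj₂ (wrapped x<N N≤x+d)) (m≤n+m d _))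

    S-no-fixed-point : ∀ {x} → x < N → S x ≢ x
    S-no-fixed-point {x} x<N Sx≡x with x + d <? N
    ... | yes x+d<N = <-irrefl (sym (+-cancelˡ-≡ x d 0 (trans (trans (sym (unwrapped x+d<N)) Sx≡x) (sym (+-identityʳ x))))) 0<d
    ... | no  x+d≮N =
      <-irrefl (+-cancelˡ-≡ x d N (trans (proj₁ (wrapped x<N (≮⇒≥ x+d≮N))) (trans (cong (N +_) Sx≡x) (+-comm N x)))) d<N

    in-order-impossible : S a < S c → S c < S b → S b < S e → ⊥
    in-order-impossible Sa<Sc Sc<Sb Sb<Se =
      S-no-fixed-point a<N (proj₁ (crossing-at Sa<Sc Sc<Sb Sb<Se (S-chord refl) (S-chord refl)))

    e-wraps : N ≤ e + d → b + d < N → c ≡ a + d × N ≡ 4 * d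
    e-wraps N≤e+d b+d<N = c≡a+d , +-cancelʳ-≡ a N (4 * d) N+a≡4d+a
      where
        open ≡-Reasoning
        c+d<N = unwrapped-below c<b b+d<N
        a+d<N = unwrapped-below a<c c+d<N
        rotated = crossing-at (wrapped<unwrapped e<N N≤e+d a+d<N) (S-mono-unwrapped a<c c+d<N)
                    (S-mono-unwrapped c<b b+d<N) (S-chord T-e) (S-chord refl)
        Se≡a = proj₁ rotated
        Sa≡c = proj₂ rotated
        c≡a+d : c ≡ a + d
        c≡a+d = trans (sym Sa≡c) (unwrapped a+d<N)
        b≡c+d : b ≡ c + d
        b≡c+d = begin
          T a       ≡⟨ cong T Se≡a ⟨
          T (S e)   ≡⟨ S-chord T-e ⟩
          S c       ≡⟨ unwrapped c+d<N ⟩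
          c + d     ∎
        e≡b+d : e ≡ b + d
        e≡b+d = begin
          T c       ≡⟨ cong T Sa≡c ⟨
          T (S a)   ≡⟨ S-chord refl ⟩
          S b       ≡⟨ unwrapped b+d<N ⟩
          b + d     ∎
        N+a≡4d+a : N + a ≡ 4 * d + a
        N+a≡4d+a = begin
          N + a               ≡⟨ cong (N +_) Se≡a ⟨
          N + S e             ≡⟨ proj₁ (wrapped e<N N≤e+d) ⟨
          e + d               ≡⟨ cong (_+ d) (trans e≡b+d (cong (_+ d) (trans b≡c+d (cong (_+ d) c≡a+d)))) ⟩
          a + d + d + d + d   ≡⟨ m+n+n+n+n≡4*n+m a d ⟩
          4 * d + a           ∎

    b-e-wrap : N ≤ b + d → c + d < N → b ≡ a + d × N ≡ 2 * d
    b-e-wrap N≤b+d c+d<N = b≡a+d , +-cancelʳ-≡ a N (2 * d) N+a≡2d+a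
      where
        open ≡-Reasoning
        a+d<N = unwrapped-below a<c c+d<N
        N≤e+d = wrapped-above b<e N≤b+d
        Sb≡a = proj₁ (crossing-at (S-mono-wrapped b<e e<N N≤b+d) (wrapped<unwrapped e<N N≤e+d a+d<N)
                        (S-mono-unwrapped a<c c+d<N) (S-chord T-b) (S-chord T-e))
        b≡a+d : b ≡ a + d
        b≡a+d = begin
          T a       ≡⟨ cong T Sb≡a ⟨
          T (S b)   ≡⟨ S-chord T-b ⟩
          S a       ≡⟨ unwrapped a+d<N ⟩
          a + d     ∎
        N+a≡2d+a : N + a ≡ 2 * d + a
        N+a≡2d+a = begin
          N + a       ≡⟨ cong (N +_) Sb≡a ⟨
          N + S b     ≡⟨ proj₁ (wrapped b<N N≤b+d) ⟨
          b + d       ≡⟨ cong (_+ d) b≡a+d ⟩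
          a + d + d   ≡⟨ m+n+n≡2*n+m a d ⟩
          2 * d + a   ∎

    c-b-e-wrap-impossible : N ≤ c + d → a + d < N → ⊥
    c-b-e-wrap-impossible N≤c+d a+d<N = <⇒≱ (+-cancelʳ-< a N (2 * d) N+a<2d+a) 2d≤N
      where
        open ≤-Reasoning
        N≤b+d = wrapped-above c<b N≤c+d
        N≤e+d = wrapped-above b<e N≤b+d
        rotated = crossing-at (S-mono-wrapped c<b b<N N≤c+d) (S-mono-wrapped b<e e<N N≤b+d)
                    (wrapped<unwrapped e<N N≤e+d a+d<N) (S-chord refl) (S-chord T-b)
        e≡a+d : e ≡ a + d
        e≡a+d = begin-equality
          T c       ≡⟨ cong T (proj₂ rotated) ⟨
          T (S b)   ≡⟨ S-chord T-b ⟩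
          S a       ≡⟨ unwrapped a+d<N ⟩
          a + d     ∎
        N+a<2d+a : N + a < 2 * d + a
        N+a<2d+a = begin-strict
          N + a       ≡⟨ cong (N +_) (proj₁ rotated) ⟨
          N + S c     ≡⟨ proj₁ (wrapped c<N N≤c+d) ⟨
          c + d       <⟨ +-monoˡ-< d (<-trans c<b b<e) ⟩
          e + d       ≡⟨ cong (_+ d) e≡a+d ⟩
          a + d + d   ≡⟨ m+n+n≡2*n+m a d ⟩
          2 * d + a   ∎

    rotation-cases : (c ≡ a + d × N ≡ 4 * d) ⊎ (b ≡ a + d × N ≡ 2 * d)
    rotation-cases with a + d <? N
    ... | no a+d≮N = ⊥-elim (in-order-impossible (S-mono-wrapped a<c c<N N≤a+d) (S-mono-wrapped c<b b<N N≤c+d)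
                               (S-mono-wrapped b<e e<N (wrapped-above c<b N≤c+d)))
      where
        N≤a+d = ≮⇒≥ a+d≮N
        N≤c+d = wrapped-above a<c N≤a+d
    ... | yes a+d<N with c + d <? N
    ...   | no c+d≮N = ⊥-elim (c-b-e-wrap-impossible (≮⇒≥ c+d≮N) a+d<N)
    ...   | yes c+d<N with b + d <? N
    ...     | no b+d≮N = inj₂ (b-e-wrap (≮⇒≥ b+d≮N) c+d<N)
    ...     | yes b+d<N with e + d <? N
    ...       | no e+d≮N  = inj₁ (e-wraps (≮⇒≥ e+d≮N) b+d<N)
    ...       | yes e+d<N = ⊥-elim (in-order-impossible (S-mono-unwrapped a<c c+d<N) (S-mono-unwrapped c<b b+d<N)
                                      (S-mono-unwrapped b<e e+d<N))

    period-parity : (N ≡ 4 * d × d % 2 ≡ 1) ⊎ (N ≡ 2 * d × d % 2 ≡ 0)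
    period-parity with rotation-cases
    ... | inj₁ (c≡a+d , N≡4d) = inj₁ (N≡4d , trans (cong (_% 2) d≡c∸a) gap-ac-odd)
      where
        d≡c∸a : d ≡ c ∸ a
        d≡c∸a = trans (sym (m+n∸m≡n a d)) (cong (_∸ a) (sym c≡a+d))
    ... | inj₂ (b≡a+d , N≡2d) = inj₂ (N≡2d , (begin
      d % 2                              ≡⟨ cong (_% 2) d≡gaps ⟩
      ((c ∸ a) + (b ∸ c)) % 2            ≡⟨ %-distribˡ-+ (c ∸ a) (b ∸ c) 2 ⟩
      ((c ∸ a) % 2 + (b ∸ c) % 2) % 2    ≡⟨ cong₂ (λ m n → (m + n) % 2) gap-ac-odd gap-cb-odd ⟩
      0                                  ∎))
      where
        open ≡-Reasoning
        d≡gaps : d ≡ (c ∸ a) + (b ∸ c)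
        d≡gaps = +-cancelˡ-≡ a d _ (begin
          a + d                      ≡⟨ b≡a+d ⟨
          b                          ≡⟨ m+[n∸m]≡n (<⇒≤ c<b) ⟨
          c + (b ∸ c)                ≡⟨ cong (_+ (b ∸ c)) (m+[n∸m]≡n (<⇒≤ a<c)) ⟨
          a + (c ∸ a) + (b ∸ c)      ≡⟨ +-assoc a (c ∸ a) (b ∸ c) ⟩
          a + ((c ∸ a) + (b ∸ c))    ∎)

σ^-cong : ∀ {N} {X Y : Fin N → Fin N} j → X ≈ₘ Y → σ^ j X ≈ₘ σ^ j Y
σ^-cong zero    X≈Y   = X≈Y
σ^-cong (suc j) X≈Y i = cong rot+ (σ^-cong j X≈Y (rot- i))

σ^-+ : ∀ {N} j k (τ : Fin N → Fin N) → σ^ (j + k) τ ≡ σ^ j (σ^ k τ)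
σ^-+ zero    k τ = refl
σ^-+ (suc j) k τ = cong σ (σ^-+ j k τ)

module _ {N} {τ : Fin N → Fin N} where

  periodic-+ : ∀ {j k} → σ^ j τ ≈ₘ τ → σ^ k τ ≈ₘ τ → σ^ (j + k) τ ≈ₘ τ
  periodic-+ {j} {k} pj pk i = trans (cong (λ f → f i) (σ^-+ j k τ)) (trans (σ^-cong j pk i) (pj i))

  periodic-* : ∀ m {j} → σ^ j τ ≈ₘ τ → σ^ (m * j) τ ≈ₘ τ
  periodic-* zero    _  _   = refl
  periodic-* (suc m) {j} pj = periodic-+ {j} {m * j} pj (periodic-* m pj)

  periodic-∸ : ∀ {j k} → k ≤ j → σ^ j τ ≈ₘ τ → σ^ k τ ≈ₘ τ → σ^ (j ∸ k) τ ≈ₘ τ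
  periodic-∸ {j} {k} k≤j pj pk i = begin
    σ^ (j ∸ k) τ i             ≡⟨ σ^-cong (j ∸ k) pk i ⟨
    σ^ (j ∸ k) (σ^ k τ) i      ≡⟨ cong (λ f → f i) (σ^-+ (j ∸ k) k τ) ⟨
    σ^ (j ∸ k + k) τ i         ≡⟨ cong (λ m → σ^ m τ i) (m∸n+n≡m k≤j) ⟩
    σ^ j τ i                   ≡⟨ pj i ⟩
    τ i                        ∎
    where open ≡-Reasoning

-- The size is written suc K so that rot+ and rot- compute.
module Circle (K : ℕ) where

  N : ℕ
  N = suc K

  fin : ℕ → Fin N
  fin x = fromℕ< (m%n<n x N)

  toℕ-fin : ∀ x → toℕ (fin x) ≡ x % N
  toℕ-fin x = toℕ-fromℕ< (m%n<n x N)

  toℕ-fin-< : ∀ {x} → x < N → toℕ (fin x) ≡ x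
  toℕ-fin-< {x} x<N = trans (toℕ-fin x) (m<n⇒m%n≡m x<N)

  fin-toℕ : ∀ i → fin (toℕ i) ≡ i
  fin-toℕ i = toℕ-injective (toℕ-fin-< (toℕ<n i))

  fin-cong-% : ∀ x y → x % N ≡ y % N → fin x ≡ fin y
  fin-cong-% x y eq = toℕ-injective (trans (toℕ-fin x) (trans eq (sym (toℕ-fin y))))

  rot-∘rot+ : ∀ i → rot- (rot+ i) ≡ i
  rot-∘rot+ i = begin
    rot- (rot+ i)               ≡⟨ cong (λ m → fin (m + K)) (toℕ-fin (suc (toℕ i))) ⟩
    fin (suc (toℕ i) % N + K)   ≡⟨ fin-cong-% (suc (toℕ i) % N + K) (suc (toℕ i) + K) ([m%n+k]%n≡[m+k]%n (suc (toℕ i)) K N) ⟩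
    fin (suc (toℕ i) + K)       ≡⟨ cong fin (+-suc (toℕ i) K) ⟨
    fin (toℕ i + N)             ≡⟨ fin-cong-% (toℕ i + N) (toℕ i) ([m+n]%n≡m%n (toℕ i) N) ⟩
    fin (toℕ i)                 ≡⟨ fin-toℕ i ⟩
    i                           ∎
    where open ≡-Reasoning

  rotate : ℕ → Fin N → Fin N
  rotate zero    i = i
  rotate (suc j) i = rot+ (rotate j i)

  rotate-fin : ∀ j x → rotate j (fin x) ≡ fin (x + j)
  rotate-fin zero    x = cong fin (sym (+-identityʳ x))
  rotate-fin (suc j) x = begin
    rot+ (rotate j (fin x))       ≡⟨ cong rot+ (rotate-fin j x) ⟩
    fin (suc (toℕ (fin (x + j)))) ≡⟨ cong (fin ∘ suc) (toℕ-fin (x + j)) ⟩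
    fin (suc ((x + j) % N))       ≡⟨ fin-cong-% (suc ((x + j) % N)) (suc (x + j)) suc-% ⟩
    fin (suc (x + j))             ≡⟨ cong fin (+-suc x j) ⟨
    fin (x + suc j)               ∎
    where
      open ≡-Reasoning
      suc-% : suc ((x + j) % N) % N ≡ suc (x + j) % N
      suc-% = trans (cong (_% N) (+-comm 1 ((x + j) % N)))
                (trans ([m%n+k]%n≡[m+k]%n (x + j) 1 N) (cong (_% N) (+-comm (x + j) 1)))

  rotate-N : ∀ i → rotate N i ≡ i
  rotate-N i = begin
    rotate N i              ≡⟨ cong (rotate N) (fin-toℕ i) ⟨
    rotate N (fin (toℕ i))  ≡⟨ rotate-fin N (toℕ i) ⟩
    fin (toℕ i + N)         ≡⟨ fin-cong-% (toℕ i + N) (toℕ i) ([m+n]%n≡m%n (toℕ i) N) ⟩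
    fin (toℕ i)             ≡⟨ fin-toℕ i ⟩
    i                       ∎
    where open ≡-Reasoning

  σ^-rotate : ∀ (τ : Fin N → Fin N) j i → σ^ j τ (rotate j i) ≡ rotate j (τ i)
  σ^-rotate τ zero    i = refl
  σ^-rotate τ (suc j) i =
    trans (cong (rot+ ∘ σ^ j τ) (rot-∘rot+ (rotate j i))) (cong rot+ (σ^-rotate τ j i))

  σ^-N : ∀ (τ : Fin N → Fin N) → σ^ N τ ≈ₘ τ
  σ^-N τ i = begin
    σ^ N τ i               ≡⟨ cong (σ^ N τ) (rotate-N i) ⟨
    σ^ N τ (rotate N i)    ≡⟨ σ^-rotate τ N i ⟩
    rotate N (τ i)         ≡⟨ rotate-N (τ i) ⟩
    τ i                    ∎
    where open ≡-Reasoning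

  periodic⇒rotate-commutes : ∀ {τ j} → σ^ j τ ≈ₘ τ → ∀ i → τ (rotate j i) ≡ rotate j (τ i)
  periodic⇒rotate-commutes {τ} {j} period i = trans (sym (period (rotate j i))) (σ^-rotate τ j i)

  rotOrder-bound : ∀ {τ d} → IsRotOrder τ d → d ≡ N ⊎ 2 * d ≤ N
  rotOrder-bound {τ} {d} (0<d , period , minimal) with <-cmp d N
  ... | tri> _ _ N<d = ⊥-elim (minimal N z<s N<d (σ^-N τ))
  ... | tri≈ _ d≡N _ = inj₁ d≡N
  ... | tri< d<N _ _ with 2 * d ≤? N
  ...   | yes 2d≤N = inj₂ 2d≤N
  ...   | no  2d≰N = ⊥-elim (minimal (2 * d ∸ N) 0<d′ d′<d (periodic-∸ N≤2d (periodic-* 2 {d} period) (σ^-N τ)))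
    where
      N≤2d = ≮⇒≥ (2d≰N ∘ <⇒≤)
      0<d′ : 0 < 2 * d ∸ N
      0<d′ = m<n⇒0<n∸m (≰⇒> 2d≰N)
      d′<d : 2 * d ∸ N < d
      d′<d = +-cancelʳ-< N (2 * d ∸ N) d (subst (_< d + N) (sym (m∸n+n≡m N≤2d))
               (subst (_< d + N) (cong (d +_) (sym (+-identityʳ d))) (+-monoʳ-< d d<N)))

  partner : (Fin N → Fin N) → ℕ → ℕ
  partner τ x = toℕ (τ (fin x))

  partner-toℕ : ∀ τ i → partner τ (toℕ i) ≡ toℕ (τ i)
  partner-toℕ τ i = cong (toℕ ∘ τ) (fin-toℕ i)

  partner-shift : ∀ {τ j} → σ^ j τ ≈ₘ τ → ∀ x → partner τ ((x + j) % N) ≡ (partner τ x + j) % N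
  partner-shift {τ} {j} period x = begin
    toℕ (τ (fin ((x + j) % N)))         ≡⟨ cong (toℕ ∘ τ) (fin-cong-% ((x + j) % N) (x + j) (m%n%n≡m%n (x + j) N)) ⟩
    toℕ (τ (fin (x + j)))               ≡⟨ cong (toℕ ∘ τ) (rotate-fin j x) ⟨
    toℕ (τ (rotate j (fin x)))          ≡⟨ cong toℕ (periodic⇒rotate-commutes {τ} {j} period (fin x)) ⟩
    toℕ (rotate j (τ (fin x)))          ≡⟨ cong (toℕ ∘ rotate j) (fin-toℕ (τ (fin x))) ⟨
    toℕ (rotate j (fin (partner τ x)))  ≡⟨ cong toℕ (rotate-fin j (partner τ x)) ⟩
    toℕ (fin (partner τ x + j))         ≡⟨ toℕ-fin (partner τ x + j) ⟩
    (partner τ x + j) % N               ∎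
    where open ≡-Reasoning

  module _ {τ : Fin N → Fin N} (matching : IsMatching τ) where

    partner-involutive : ∀ {x} → x < N → partner τ (partner τ x) ≡ x
    partner-involutive {x} x<N = begin
      partner τ (toℕ (τ (fin x)))   ≡⟨ partner-toℕ τ (τ (fin x)) ⟩
      toℕ (τ (τ (fin x)))           ≡⟨ cong toℕ (proj₁ (matching (fin x))) ⟩
      toℕ (fin x)                   ≡⟨ toℕ-fin-< x<N ⟩
      x                             ∎
      where open ≡-Reasoning

    partner-no-fixed-point : ∀ {x} → x < N → partner τ x ≢ x
    partner-no-fixed-point {x} x<N eq = proj₂ (matching (fin x)) (toℕ-injective (trans eq (sym (toℕ-fin-< x<N))))

  module _ {τ : Fin N → Fin N} where
    open Crossings τ

    crossingPair⇒Crosses : ∀ {a c} → CrossingPair a c → Crosses (partner τ) (toℕ a) (toℕ c)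
    crossingPair⇒Crosses {a} {c} p rewrite partner-toℕ τ a | partner-toℕ τ c = p

    Crosses⇒crossingPair : ∀ {x y} → Crosses (partner τ) x y → CrossingPair (fin x) (fin y)
    Crosses⇒crossingPair {x} {y} cross@(x<y , y<Tx , _)
      rewrite toℕ-fin-< (<-trans x<y (<-trans y<Tx (toℕ<n _))) | toℕ-fin-< (<-trans y<Tx (toℕ<n _)) = cross

    one-crossing⇒unique-Crosses : crossings τ ≡ 1 →
      ∃₂ λ a c → Crosses (partner τ) a c × (∀ {x y} → Crosses (partner τ) x y → x ≡ a × y ≡ c)
    one-crossing⇒unique-Crosses one with one-crossing⇒crossingPair one
    ... | a , c , a-c-cross = toℕ a , toℕ c , crossingPair⇒Crosses a-c-cross , unique
      where
        unique : ∀ {x y} → Crosses (partner τ) x y → x ≡ toℕ a × y ≡ toℕ c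
        unique {x} {y} cross@(x<y , y<Tx , _) with crossingPair-unique one (Crosses⇒crossingPair cross) a-c-cross
        ... | fin-x≡a , fin-y≡c =
          trans (sym (toℕ-fin-< (<-trans x<y y<N))) (cong toℕ fin-x≡a) ,
          trans (sym (toℕ-fin-< y<N)) (cong toℕ fin-y≡c)
          where y<N = <-trans y<Tx (toℕ<n _)

  rotOrder-classification : ∀ {τ d} → IsMatching τ → crossings τ ≡ 1 → IsRotOrder τ d →
    d ≡ N ⊎ (N ≡ 4 * d × d % 2 ≡ 1) ⊎ (N ≡ 2 * d × d % 2 ≡ 0)
  rotOrder-classification {τ} {d} matching one order@(0<d , period , _)
    with rotOrder-bound order | one-crossing⇒unique-Crosses {τ} one
  ... | inj₁ d≡N  | _ = inj₁ d≡N
  ... | inj₂ 2d≤N | a , c , a-c-cross , unique = inj₂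
    (OneCrossing.Rotated.period-parity (partner τ) (λ x → toℕ<n (τ (fin x)))
      (partner-involutive {τ} matching) (partner-no-fixed-point {τ} matching) a-c-cross unique
      d 0<d 2d≤N (partner-shift {τ} {d} period))

rotOrder-cases⇒statement : ∀ n d → d ≡ 2 * n ⊎ (2 * n ≡ 4 * d × d % 2 ≡ 1) ⊎ (2 * n ≡ 2 * d × d % 2 ≡ 0) →
                           ((d ≡ 2 * n) ⊎ (d ≡ n) ⊎ (2 * d ≡ n))
                           × ((n % 2 ≡ 1) → d ≡ 2 * n)
                           × ((n % 4 ≡ 0) → (d ≡ 2 * n) ⊎ (d ≡ n))
                           × ((n % 4 ≡ 2) → (d ≡ 2 * n) ⊎ (d ≡ n) ⊎ (2 * d ≡ n))
rotOrder-cases⇒statement n d (inj₁ d≡2n) = inj₁ d≡2n , const d≡2n , const (inj₁ d≡2n) , const (inj₁ d≡2n)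
rotOrder-cases⇒statement n d (inj₂ (inj₁ (2n≡4d , d%2≡1))) =
  inj₂ (inj₂ 2d≡n) ,
  (λ n%2≡1 → ⊥-elim (0≢1+n (trans (sym n%2≡0) n%2≡1))) ,
  (λ n%4≡0 → ⊥-elim (1+n≢0 (trans (sym n%4≡2) n%4≡0))) ,
  const (inj₂ (inj₂ 2d≡n))
  where
    open ≡-Reasoning
    2d≡n : 2 * d ≡ n
    2d≡n = *-cancelˡ-≡ (2 * d) n 2 (trans (sym (*-assoc 2 2 d)) (sym 2n≡4d))
    n≡d*2 : n ≡ d * 2
    n≡d*2 = trans (sym 2d≡n) (*-comm 2 d)
    n%2≡0 : n % 2 ≡ 0
    n%2≡0 = trans (cong (_% 2) n≡d*2) (m*n%n≡0 d 2)
    n%4≡2 : n % 4 ≡ 2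
    n%4≡2 = begin
      n % 4          ≡⟨ cong (_% 4) n≡d*2 ⟩
      d * 2 % 4      ≡⟨ m%n*o≡m*o%[n*o] d 2 2 ⟨
      d % 2 * 2      ≡⟨ cong (_* 2) d%2≡1 ⟩
      2              ∎
rotOrder-cases⇒statement n d (inj₂ (inj₂ (2n≡2d , d%2≡0))) =
  inj₂ (inj₁ d≡n) ,
  (λ n%2≡1 → ⊥-elim (0≢1+n (trans (sym n%2≡0) n%2≡1))) ,
  const (inj₂ d≡n) ,
  const (inj₂ (inj₁ d≡n))
  where
    d≡n : d ≡ n
    d≡n = *-cancelˡ-≡ d n 2 (sym 2n≡2d)
    n%2≡0 : n % 2 ≡ 0
    n%2≡0 = trans (cong (_% 2) (sym d≡n)) d%2≡0

mainTheorem3 : (n : ℕ) → 0 < n → (τ : Fin (2 * n) → Fin (2 * n)) → InP1 n τ →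
               (d : ℕ) → IsRotOrder τ d →
               ((d ≡ 2 * n) ⊎ (d ≡ n) ⊎ (2 * d ≡ n))
               × ((n % 2 ≡ 1) → d ≡ 2 * n)
               × ((n % 4 ≡ 0) → (d ≡ 2 * n) ⊎ (d ≡ n))
               × ((n % 4 ≡ 2) → (d ≡ 2 * n) ⊎ (d ≡ n) ⊎ (2 * d ≡ n))
mainTheorem3 (suc k) _ τ (matching , one) d order =
  rotOrder-cases⇒statement (suc k) d (Circle.rotOrder-classification _ matching one order)
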